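{- Let $p,q$ be positive integers with $p+q\geq 4$ and $p<q$, and let $\{P,Q\}$ be the vertex bipartition of the complete bipartite graph $K_{p,q}$ with $|P|=p$ and $|Q|=q$. Then $P$ is the only differential set of $R(K_{p,q})$.
   Context: For a graph $G$, $R(G)$ is the graph obtained from $G$ by adding, for each edge $e=xy\in E(G)$, a new vertex $v_e$ adjacent exactly to $x$ and $y$. For a graph $H$ and $S\subseteq V(H)$, $B_H(S)$ is the set of vertices not in $S$ adjacent to some vertex of $S$, $\partial_H(S)=|B_H(S)|-|S|$, $\partial(H)=\max_{S\subseteq V(H)}\partial_H(S)$, and $S$ is a differential set of $H$ if $\partial_H(S)=\partial(H)$. -}

module Defs where

open import Data.Nat using (ℕ; _<?_)
open import Data.Bool using (Bool; true; false; not; _∧_; _∨_; if_then_else_)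
open import Data.Fin using (Fin; splitAt; _<?_) renaming (_≟_ to _≟ᶠ_)
open import Data.Fin.Subset using (Subset; ∣_∣)
open import Data.Vec using (Vec; tabulate; lookup)
open import Data.List using (List; filter; allFin; cartesianProduct; length)
import Data.List as L
open import Data.Product using (_×_; _,_; proj₁; proj₂)
open import Data.Sum using (_⊎_; inj₁; inj₂)
open import Data.Integer using (ℤ; _-_; _≤_) renaming (+_ to ℤ+)
open import Relation.Nullary.Decidable using (⌊_⌋)
open import Relation.Binary.PropositionalEquality using (_≡_)

record Graph : Set where
  constructor graph
  field
    n   : ℕ
    adj : Fin n → Fin n → Bool
open Graph public

anyFin : ∀ {k} → (Fin k → Bool) → Bool
anyFin f = L.foldr (λ x b → f x ∨ b) false (allFin _)

boundary : (H : Graph) → Subset (n H) → Subset (n H)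
boundary H S = tabulate λ v → not (lookup S v) ∧ anyFin (λ u → lookup S u ∧ adj H u v)

diff : (H : Graph) → Subset (n H) → ℤ
diff H S = ℤ+ ∣ boundary H S ∣ - ℤ+ ∣ S ∣

IsDifferential : (H : Graph) → Subset (n H) → Set
IsDifferential H S = ∀ (T : Subset (n H)) → diff H T ≤ diff H S

edges : (G : Graph) → List (Fin (n G) × Fin (n G))
edges G = filter (λ e → Data.Fin._<?_ (proj₁ e) (proj₂ e) Relation.Nullary.Decidable.×-dec
                        (adj G (proj₁ e) (proj₂ e) Data.Bool.≟ true))
                 (cartesianProduct (allFin (n G)) (allFin (n G)))
  where import Relation.Nullary.Decidable
        import Data.Bool

numEdges : Graph → ℕ
numEdges G = length (edges G)

isEnd : (G : Graph) → Fin (n G) → Fin (numEdges G) → Bool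
isEnd G x k = ⌊ x ≟ᶠ proj₁ e ⌋ ∨ ⌊ x ≟ᶠ proj₂ e ⌋
  where e = L.lookup (edges G) k

-- R(G): vertex set Fin (n + m); the first n vertices are those of G,
-- vertex n + k is the new vertex v_e for the k-th edge e, adjacent
-- exactly to the two endpoints of e.
R : Graph → Graph
R G = graph (n G Data.Nat.+ numEdges G) adjR
  where
    import Data.Nat
    adjR : Fin (n G Data.Nat.+ numEdges G) → Fin (n G Data.Nat.+ numEdges G) → Bool
    adjR x y with splitAt (n G) x | splitAt (n G) y
    ... | inj₁ a | inj₁ b = adj G a b
    ... | inj₁ a | inj₂ k = isEnd G a k
    ... | inj₂ k | inj₁ b = isEnd G b k
    ... | inj₂ _ | inj₂ _ = false

-- which side of K_{p,q} a vertex of Fin (p + q) lies on (true = P)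
inP : (p q : ℕ) → Fin (p Data.Nat.+ q) → Bool
inP p q x with splitAt p x
... | inj₁ _ = true
... | inj₂ _ = false
  where import Data.Nat

-- the complete bipartite graph K_{p,q} on Fin (p + q):
-- P = first p vertices, Q = last q vertices
K : ℕ → ℕ → Graph
K p q = graph (p Data.Nat.+ q) (λ x y → not ⌊ inP p q x Data.Bool.≟ inP p q y ⌋)
  where import Data.Nat
        import Data.Bool

Pset : (p q : ℕ) → Subset (n (R (K p q)))
Pset p q = tabulate λ x → f (splitAt (p Data.Nat.+ q) x)
  where import Data.Nat
        f : _ → Bool
        f (inj₁ a) = inP p q a
        f (inj₂ _) = false

-- Let U(S) be the set of vertices neither in S nor adjacent to S. Since V = S ⊔ B(S) ⊔ U(S),
-- ∂(S) = |V| - (2|S| + |U(S)|), so the differential sets are those of least cost 2|S| + |U(S)|.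
-- In R(K_{p,q}) the set P dominates every vertex, so its cost is 2p. For any S write
-- a = |S ∩ P|, x = |P ∖ S|, b = |S ∩ Q|, y = |Q ∖ S| and c for the number of edge vertices in S.
-- Each of the xy edges between P ∖ S and Q ∖ S has its edge vertex in S or in U(S), so
-- |U(S)| ≥ xy - c, and the cost of S exceeds 2p by at least 2b + c + xy - 2x. This is
-- nonnegative because x < b + y (as p < q), and for q ≥ 3 it vanishes only if x = b = c = 0,
-- i.e. S = P.

module Submission where

open import Defs
open import Data.Nat.Properties
open import Algebra.Properties.CommutativeSemigroup +-commutativeSemigroup using (xy∙z≈xz∙y; interchange)
open import Algebra.Properties.Semiring.Sum +-*-semiring
  using (sum; sum-cong-≗; ∑-distrib-+; *-distribˡ-sum; *-distribʳ-sum; sum-remove; sum-replicate-zero)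
open import Data.Bool using (Bool; true; false; not; _∧_; _∨_; if_then_else_)
import Data.Bool as Bool
open import Data.Bool.Properties using (∨-zeroʳ; ∧-zeroʳ; not-injective)
open import Data.Fin as Fin using (Fin; zero; suc; _↑ˡ_; _↑ʳ_; splitAt; join)
open import Data.Fin.Properties
  using (join-splitAt; splitAt-↑ˡ; splitAt-↑ʳ; splitAt⁻¹-↑ˡ; splitAt⁻¹-↑ʳ; toℕ-↑ˡ; toℕ-↑ʳ; toℕ<n)
open import Data.Fin.Subset using (Subset; ∣_∣)
open import Data.Integer as ℤ using (_⊖_)
import Data.Integer.Properties as ℤ
open import Data.List as List using (List; []; _∷_; filter; cartesianProduct; allFin)
import Data.List.Properties as Listₚ
open import Data.List.Membership.Propositional using (_∈_)
open import Data.List.Membership.Propositional.Properties using (∈-allFin; ∈-lookup; ∈-filter⁻)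
open import Data.List.Relation.Unary.Any using (here; there)
open import Data.Nat using (ℕ; zero; suc; _+_; _*_; _≤_; _<_; z≤n; s≤s; s≤s⁻¹)
import Data.Nat.ListAction as ListAction
import Data.Nat.ListAction.Properties as ListActionₚ
open import Data.Nat.Tactic.RingSolver using (solve-∀)
open import Data.Product using (_×_; _,_; proj₁; proj₂; ∃)
open import Data.Sum using (_⊎_; inj₁; inj₂)
open import Data.Vec using ([]; _∷_; tabulate; lookup)
open import Data.Vec.Properties using (lookup∘tabulate; tabulate∘lookup; tabulate-cong)
open import Function using (_∘_; id; _∋_)
open import Relation.Binary.PropositionalEquality
open import Relation.Nullary using (does; yes; no; contradiction)
open import Relation.Nullary.Decidable using (_×-dec_; dec-true)
open import Relation.Unary using (Decidable)

-- Counting with finite sums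

χ : Bool → ℕ
χ true  = 1
χ false = 0

χ≤1 : ∀ b → χ b ≤ 1
χ≤1 true  = s≤s z≤n
χ≤1 false = z≤n

χ-∧ : ∀ a b → χ (a ∧ b) ≡ χ a * χ b
χ-∧ true  b = sym (+-identityʳ (χ b))
χ-∧ false b = refl

χ+χ-not : ∀ b → χ b + χ (not b) ≡ 1
χ+χ-not true  = refl
χ+χ-not false = refl

χ≡0⇒false : ∀ {b} → χ b ≡ 0 → b ≡ false
χ≡0⇒false {false} _ = refl

sum-mono-≤ : ∀ {n} {f g : Fin n → ℕ} → (∀ i → f i ≤ g i) → sum f ≤ sum g
sum-mono-≤ {zero}  _   = z≤n
sum-mono-≤ {suc n} f≤g = +-mono-≤ (f≤g zero) (sum-mono-≤ (f≤g ∘ suc))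

≤-sum : ∀ {n} (f : Fin n → ℕ) i → f i ≤ sum f
≤-sum {suc n} f i = subst (f i ≤_) (sym (sum-remove {i = i} f)) (m≤m+n (f i) _)

sum≡0⇒≡0 : ∀ {n} (f : Fin n → ℕ) → sum f ≡ 0 → ∀ i → f i ≡ 0
sum≡0⇒≡0 f sum≡0 i = n≤0⇒n≡0 (subst (f i ≤_) sum≡0 (≤-sum f i))

sum-zero : ∀ {n} {f : Fin n → ℕ} → (∀ i → f i ≡ 0) → sum f ≡ 0
sum-zero {n} f≡0 = trans (sum-cong-≗ f≡0) (sum-replicate-zero n)

sum-ones : ∀ n → sum {n} (λ _ → 1) ≡ n
sum-ones zero    = refl
sum-ones (suc n) = cong suc (sum-ones n)

sum-↑ˡ-↑ʳ : ∀ m {n} (f : Fin (m + n) → ℕ) → sum f ≡ sum (f ∘ (_↑ˡ n)) + sum (f ∘ (m ↑ʳ_))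
sum-↑ˡ-↑ʳ zero    f = refl
sum-↑ˡ-↑ʳ (suc m) f = trans (cong (f zero +_) (sum-↑ˡ-↑ʳ m (f ∘ suc))) (sym (+-assoc (f zero) _ _))

sum-↑ˡ-≤ : ∀ m {n} (f : Fin (m + n) → ℕ) → sum (f ∘ (_↑ˡ n)) ≤ sum f
sum-↑ˡ-≤ m f = ≤-trans (m≤m+n _ _) (≤-reflexive (sym (sum-↑ˡ-↑ʳ m f)))

sum-↑ʳ-≤ : ∀ m {n} (f : Fin (m + n) → ℕ) → sum (f ∘ (m ↑ʳ_)) ≤ sum f
sum-↑ʳ-≤ m f = ≤-trans (m≤n+m _ _) (≤-reflexive (sym (sum-↑ˡ-↑ʳ m f)))

sum-χ+χ-not : ∀ {n} (f : Fin n → Bool) → sum (χ ∘ f) + sum (χ ∘ not ∘ f) ≡ n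
sum-χ+χ-not {n} f = begin
  sum (χ ∘ f) + sum (χ ∘ not ∘ f)   ≡⟨ ∑-distrib-+ (χ ∘ f) (χ ∘ not ∘ f) ⟨
  sum (λ i → χ (f i) + χ (not (f i))) ≡⟨ sum-cong-≗ (χ+χ-not ∘ f) ⟩
  sum {n} (λ _ → 1)                   ≡⟨ sum-ones n ⟩
  n                                   ∎
  where open ≡-Reasoning

∣∣≡sum-χ : ∀ {n} (S : Subset n) → ∣ S ∣ ≡ sum (χ ∘ lookup S)
∣∣≡sum-χ []          = refl
∣∣≡sum-χ (true ∷ S)  = cong suc (∣∣≡sum-χ S)
∣∣≡sum-χ (false ∷ S) = ∣∣≡sum-χ S

∣tabulate∣≡sum-χ : ∀ {n} (f : Fin n → Bool) → ∣ tabulate f ∣ ≡ sum (χ ∘ f)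
∣tabulate∣≡sum-χ f = trans (∣∣≡sum-χ (tabulate f)) (sum-cong-≗ (cong χ ∘ lookup∘tabulate f))

sum-lookup : ∀ {A : Set} (h : A → ℕ) (xs : List A) → sum (h ∘ List.lookup xs) ≡ ListAction.sum (List.map h xs)
sum-lookup h []       = refl
sum-lookup h (x ∷ xs) = cong (h x +_) (sum-lookup h xs)

sum-filter : ∀ {A : Set} {P : A → Set} (P? : Decidable P) (h : A → ℕ) (xs : List A) →
  ListAction.sum (List.map h (filter P? xs)) ≡ ListAction.sum (List.map (λ x → if does (P? x) then h x else 0) xs)
sum-filter P? h []       = refl
sum-filter P? h (x ∷ xs) with does (P? x)
... | true  = cong (h x +_) (sum-filter P? h xs)
... | false = sum-filter P? h xs

sum-cartesianProduct : ∀ {A B : Set} (h : A × B → ℕ) (xs : List A) (ys : List B) →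
  ListAction.sum (List.map h (cartesianProduct xs ys)) ≡ ListAction.sum (List.map (λ x → ListAction.sum (List.map (h ∘ (x ,_)) ys)) xs)
sum-cartesianProduct h []       ys = refl
sum-cartesianProduct h (x ∷ xs) ys = begin
  ListAction.sum (List.map h (List.map (x ,_) ys List.++ cartesianProduct xs ys))
    ≡⟨ cong ListAction.sum (Listₚ.map-++ h (List.map (x ,_) ys) (cartesianProduct xs ys)) ⟩
  ListAction.sum (List.map h (List.map (x ,_) ys) List.++ List.map h (cartesianProduct xs ys))
    ≡⟨ ListActionₚ.sum-++ (List.map h (List.map (x ,_) ys)) _ ⟩
  ListAction.sum (List.map h (List.map (x ,_) ys)) + ListAction.sum (List.map h (cartesianProduct xs ys))
    ≡⟨ cong₂ _+_ (cong ListAction.sum (sym (Listₚ.map-∘ ys))) (sum-cartesianProduct h xs ys) ⟩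
  _ ∎
  where open ≡-Reasoning

sum-allFin : ∀ {n} (h : Fin n → ℕ) → ListAction.sum (List.map h (allFin n)) ≡ sum h
sum-allFin h = trans (cong ListAction.sum (Listₚ.map-tabulate id h)) (sum-tabulate h)
  where
  sum-tabulate : ∀ {n} (f : Fin n → ℕ) → ListAction.sum (List.tabulate f) ≡ sum f
  sum-tabulate {zero}  f = refl
  sum-tabulate {suc n} f = cong (f zero +_) (sum-tabulate (f ∘ suc))

↑ˡ-↑ʳ-ext : ∀ {A : Set} m {n} {f g : Fin (m + n) → A} →
  (∀ i → f (i ↑ˡ n) ≡ g (i ↑ˡ n)) → (∀ j → f (m ↑ʳ j) ≡ g (m ↑ʳ j)) → ∀ v → f v ≡ g v
↑ˡ-↑ʳ-ext m {n} {f} {g} eqˡ eqʳ v = subst (λ w → f w ≡ g w) (join-splitAt m n v) (by-cases (splitAt m v))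
  where
  by-cases : ∀ s → f (join m n s) ≡ g (join m n s)
  by-cases (inj₁ i) = eqˡ i
  by-cases (inj₂ j) = eqʳ j

-- Domination and the differential

anyFin-true : ∀ {k} (f : Fin k → Bool) w → f w ≡ true → anyFin f ≡ true
anyFin-true {k} f w fw≡true = go (allFin k) (∈-allFin w)
  where
  go : ∀ xs → w ∈ xs → List.foldr (λ x b → f x ∨ b) false xs ≡ true
  go (x ∷ xs) (here refl) rewrite fw≡true = refl
  go (x ∷ xs) (there w∈xs) rewrite go xs w∈xs = ∨-zeroʳ (f x)

anyFin-false : ∀ {k} (f : Fin k → Bool) → (∀ w → f w ≡ false) → anyFin f ≡ false
anyFin-false {k} f f≡false = go (allFin k)
  where
  go : ∀ xs → List.foldr (λ x b → f x ∨ b) false xs ≡ false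
  go []       = refl
  go (x ∷ xs) rewrite f≡false x = go xs

dominated : (H : Graph) → Subset (n H) → Fin (n H) → Bool
dominated H S v = anyFin (λ u → lookup S u ∧ adj H u v)

undominated : (H : Graph) → Subset (n H) → Subset (n H)
undominated H S = tabulate λ v → not (lookup S v) ∧ not (dominated H S v)

cost : (H : Graph) → Subset (n H) → ℕ
cost H S = ∣ S ∣ + ∣ S ∣ + ∣ undominated H S ∣

∣S∣+∣boundary∣+∣undominated∣≡n : ∀ H S → ∣ S ∣ + ∣ boundary H S ∣ + ∣ undominated H S ∣ ≡ n H
∣S∣+∣boundary∣+∣undominated∣≡n H S = begin
  ∣ S ∣ + ∣ boundary H S ∣ + ∣ undominated H S ∣
    ≡⟨ cong₂ _+_ (cong₂ _+_ (∣∣≡sum-χ S) (∣tabulate∣≡sum-χ inB)) (∣tabulate∣≡sum-χ inU) ⟩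
  sum (χ ∘ inS) + sum (χ ∘ inB) + sum (χ ∘ inU)
    ≡⟨ cong (_+ sum (χ ∘ inU)) (∑-distrib-+ (χ ∘ inS) (χ ∘ inB)) ⟨
  sum (λ v → χ (inS v) + χ (inB v)) + sum (χ ∘ inU)
    ≡⟨ ∑-distrib-+ (λ v → χ (inS v) + χ (inB v)) (χ ∘ inU) ⟨
  sum (λ v → χ (inS v) + χ (inB v) + χ (inU v))
    ≡⟨ sum-cong-≗ (λ v → partition (inS v) (dominated H S v)) ⟩
  sum {n H} (λ _ → 1)
    ≡⟨ sum-ones (n H) ⟩
  n H ∎
  where
  open ≡-Reasoning
  inS inB inU : Fin (n H) → Bool
  inS = lookup S
  inB v = not (inS v) ∧ dominated H S v
  inU v = not (inS v) ∧ not (dominated H S v)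
  partition : ∀ a b → χ a + χ (not a ∧ b) + χ (not a ∧ not b) ≡ 1
  partition true  _     = refl
  partition false true  = refl
  partition false false = refl

diff≡n⊖cost : ∀ H S → diff H S ≡ n H ⊖ cost H S
diff≡n⊖cost H S = begin
  diff H S                        ≡⟨ ℤ.m-n≡m⊖n β s ⟩
  β ⊖ s                           ≡⟨ ℤ.+-cancelˡ-⊖ (s + u) β s ⟨
  (s + u + β) ⊖ (s + u + s)       ≡⟨ cong₂ _⊖_ (xy∙z≈xz∙y s u β) (xy∙z≈xz∙y s u s) ⟩
  (s + β + u) ⊖ (s + s + u)       ≡⟨ cong (_⊖ cost H S) (∣S∣+∣boundary∣+∣undominated∣≡n H S) ⟩
  n H ⊖ cost H S                  ∎
  where
  open ≡-Reasoning
  s β u : ℕ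
  s = ∣ S ∣
  β = ∣ boundary H S ∣
  u = ∣ undominated H S ∣

cost-≤⇒diff-≥ : ∀ H S T → cost H S ≤ cost H T → diff H T ℤ.≤ diff H S
cost-≤⇒diff-≥ H S T cS≤cT =
  subst₂ ℤ._≤_ (sym (diff≡n⊖cost H T)) (sym (diff≡n⊖cost H S)) (ℤ.⊖-monoʳ-≥-≤ (n H) cS≤cT)

diff-≤⇒cost-≥ : ∀ H S T → diff H T ℤ.≤ diff H S → cost H S ≤ cost H T
diff-≤⇒cost-≥ H S T dT≤dS = ≮⇒≥ λ cT<cS → ℤ.<⇒≱
  (subst₂ ℤ._<_ (sym (diff≡n⊖cost H S)) (sym (diff≡n⊖cost H T)) (ℤ.⊖-monoʳ->-< (n H) cT<cS)) dT≤dS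

-- The arithmetic core

x+x≤b+b+x*y : ∀ x b y → x < b + y → x + x ≤ b + b + x * y
x+x≤b+b+x*y x b zero x<b+0 = begin
  x + x         ≤⟨ +-mono-≤ x≤b x≤b ⟩
  b + b         ≤⟨ m≤m+n (b + b) (x * 0) ⟩
  b + b + x * 0 ∎
  where
  open ≤-Reasoning
  x≤b : x ≤ b
  x≤b = <⇒≤ (subst (x <_) (+-identityʳ b) x<b+0)
x+x≤b+b+x*y x b 1 x<b+1 = begin
  x + x         ≤⟨ +-monoˡ-≤ x (s≤s⁻¹ (subst (x <_) (+-comm b 1) x<b+1)) ⟩
  b + x         ≤⟨ +-monoˡ-≤ x (m≤m+n b b) ⟩
  b + b + x     ≡⟨ cong (b + b +_) (*-identityʳ x) ⟨
  b + b + x * 1 ∎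
  where open ≤-Reasoning
x+x≤b+b+x*y x b y@(suc (suc _)) _ = begin
  x + x         ≡⟨ trans (*-suc x 1) (cong (x +_) (*-identityʳ x)) ⟨
  x * 2         ≤⟨ *-monoʳ-≤ x (s≤s (s≤s z≤n)) ⟩
  x * y         ≤⟨ m≤n+m (x * y) (b + b) ⟩
  b + b + x * y ∎
  where open ≤-Reasoning

b+b+c+x*y≤x+x⇒x≡b≡c≡0 : ∀ x b y c → x < b + y → 3 ≤ b + y → b + b + c + x * y ≤ x + x →
  x ≡ 0 × b ≡ 0 × c ≡ 0
b+b+c+x*y≤x+x⇒x≡b≡c≡0 x b zero c x<b+0 _ tight = contradiction (begin
  b + b         ≤⟨ m≤m+n (b + b) c ⟩
  b + b + c     ≤⟨ m≤m+n (b + b + c) (x * 0) ⟩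
  b + b + c + x * 0 ≤⟨ tight ⟩
  x + x         ∎) (<⇒≱ (+-mono-< x<b x<b))
  where
  open ≤-Reasoning
  x<b : x < b
  x<b = subst (x <_) (+-identityʳ b) x<b+0
b+b+c+x*y≤x+x⇒x≡b≡c≡0 x b 1 c x<b+1 3≤b+1 tight = contradiction (begin
  b + b ≤⟨ +-cancelʳ-≤ x (b + b) x (begin
    b + b + x         ≤⟨ +-monoˡ-≤ x (m≤m+n (b + b) c) ⟩
    b + b + c + x     ≡⟨ cong (b + b + c +_) (*-identityʳ x) ⟨
    b + b + c + x * 1 ≤⟨ tight ⟩
    x + x             ∎) ⟩
  x     ≤⟨ s≤s⁻¹ (subst (x <_) (+-comm b 1) x<b+1) ⟩
  b     ∎) (<⇒≱ (m<m+n b (<⇒≤ (s≤s⁻¹ (subst (3 ≤_) (+-comm b 1) 3≤b+1)))))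
  where open ≤-Reasoning
b+b+c+x*y≤x+x⇒x≡b≡c≡0 x b (suc (suc y)) c _ 3≤b+2+y tight = x≡0 , b≡0 , c≡0
  where
  open ≤-Reasoning
  shuffle : ∀ b c x y → b + b + c + x * y + (x + x) ≡ b + b + c + x * suc (suc y)
  shuffle = solve-∀
  rest≡0 : b + b + c + x * y ≡ 0
  rest≡0 = n≤0⇒n≡0 (+-cancelʳ-≤ (x + x) _ 0 (begin
    b + b + c + x * y + (x + x) ≡⟨ shuffle b c x y ⟩
    b + b + c + x * suc (suc y) ≤⟨ tight ⟩
    x + x                       ∎))
  b≡0 : b ≡ 0
  b≡0 = m+n≡0⇒m≡0 b (m+n≡0⇒m≡0 (b + b) (m+n≡0⇒m≡0 (b + b + c) rest≡0))
  c≡0 : c ≡ 0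
  c≡0 = m+n≡0⇒n≡0 (b + b) (m+n≡0⇒m≡0 (b + b + c) rest≡0)
  x≡0 : x ≡ 0
  x≡0 with m*n≡0⇒m≡0∨n≡0 x (m+n≡0⇒n≡0 (b + b + c) rest≡0)
  ... | inj₁ x≡0 = x≡0
  ... | inj₂ refl = contradiction (subst (λ b → 3 ≤ b + 2) b≡0 3≤b+2+y) λ { (s≤s (s≤s ())) }

-- Edges and the graph R(G)

isEdge? : (G : Graph) →
  Decidable λ (e : Fin (n G) × Fin (n G)) → proj₁ e Fin.< proj₂ e × adj G (proj₁ e) (proj₂ e) ≡ true
isEdge? G e = (proj₁ e Fin.<? proj₂ e) ×-dec (adj G (proj₁ e) (proj₂ e) Bool.≟ true)

edge : (G : Graph) → Fin (numEdges G) → Fin (n G) × Fin (n G)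
edge G = List.lookup (edges G)

sum-edges : ∀ G (h : Fin (n G) × Fin (n G) → ℕ) →
  sum (h ∘ edge G) ≡ sum λ u → sum λ w → if does (isEdge? G (u , w)) then h (u , w) else 0
sum-edges G h = begin
  sum (h ∘ edge G)
    ≡⟨ sum-lookup h (edges G) ⟩
  ListAction.sum (List.map h (edges G))
    ≡⟨ sum-filter (isEdge? G) h (cartesianProduct (allFin (n G)) (allFin (n G))) ⟩
  ListAction.sum (List.map h′ (cartesianProduct (allFin (n G)) (allFin (n G))))
    ≡⟨ sum-cartesianProduct h′ (allFin (n G)) (allFin (n G)) ⟩
  ListAction.sum (List.map (λ u → ListAction.sum (List.map (h′ ∘ (u ,_)) (allFin (n G)))) (allFin (n G)))
    ≡⟨ sum-allFin (λ u → ListAction.sum (List.map (h′ ∘ (u ,_)) (allFin (n G)))) ⟩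
  sum (λ u → ListAction.sum (List.map (h′ ∘ (u ,_)) (allFin (n G))))
    ≡⟨ sum-cong-≗ (λ u → sum-allFin (h′ ∘ (u ,_))) ⟩
  sum (λ u → sum (h′ ∘ (u ,_))) ∎
  where
  open ≡-Reasoning
  h′ : Fin (n G) × Fin (n G) → ℕ
  h′ e = if does (isEdge? G e) then h e else 0

edge-isEdge : ∀ G k → proj₁ (edge G k) Fin.< proj₂ (edge G k) × adj G (proj₁ (edge G k)) (proj₂ (edge G k)) ≡ true
edge-isEdge G k = proj₂ (∈-filter⁻ (isEdge? G) {xs = cartesianProduct (allFin (n G)) (allFin (n G))} (∈-lookup k))

endpoint-isEnd : ∀ G k → isEnd G (proj₁ (edge G k)) k ≡ true
endpoint-isEnd G k with proj₁ (edge G k) Fin.≟ proj₁ (edge G k)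
... | yes _   = refl
... | no e₁≢e₁ = contradiction refl e₁≢e₁

vertex : (G : Graph) → Fin (n G) → Fin (n (R G))
vertex G x = x ↑ˡ numEdges G

edgeVertex : (G : Graph) → Fin (numEdges G) → Fin (n (R G))
edgeVertex G k = n G ↑ʳ k

adj-R-vertex-vertex : ∀ G x y → adj (R G) (vertex G x) (vertex G y) ≡ adj G x y
adj-R-vertex-vertex G x y rewrite splitAt-↑ˡ (n G) x (numEdges G) | splitAt-↑ˡ (n G) y (numEdges G) = refl

adj-R-vertex-edgeVertex : ∀ G x k → adj (R G) (vertex G x) (edgeVertex G k) ≡ isEnd G x k
adj-R-vertex-edgeVertex G x k rewrite splitAt-↑ˡ (n G) x (numEdges G) | splitAt-↑ʳ (n G) (numEdges G) k = refl

adj-R-edgeVertex-edgeVertex : ∀ G k l → adj (R G) (edgeVertex G k) (edgeVertex G l) ≡ false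
adj-R-edgeVertex-edgeVertex G k l rewrite splitAt-↑ʳ (n G) (numEdges G) k | splitAt-↑ʳ (n G) (numEdges G) l = refl

edgeVertex-undominated : ∀ G S k →
  lookup S (vertex G (proj₁ (edge G k))) ≡ false → lookup S (vertex G (proj₂ (edge G k))) ≡ false →
  dominated (R G) S (edgeVertex G k) ≡ false
edgeVertex-undominated G S k e₁∉S e₂∉S = anyFin-false _
  (↑ˡ-↑ʳ-ext (n G) {g = λ _ → false} from-vertex from-edgeVertex)
  where
  from-vertex : ∀ x → (lookup S (vertex G x) ∧ adj (R G) (vertex G x) (edgeVertex G k)) ≡ false
  from-vertex x rewrite adj-R-vertex-edgeVertex G x k
    with x Fin.≟ proj₁ (edge G k) | x Fin.≟ proj₂ (edge G k)
  ... | yes refl | _      rewrite e₁∉S = refl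
  ... | no _     | yes refl rewrite e₂∉S = refl
  ... | no _     | no _   = ∧-zeroʳ _
  from-edgeVertex : ∀ l → (lookup S (edgeVertex G l) ∧ adj (R G) (edgeVertex G l) (edgeVertex G k)) ≡ false
  from-edgeVertex l rewrite adj-R-edgeVertex-edgeVertex G l k = ∧-zeroʳ _

edges-avoiding-≤ : ∀ G (S : Subset (n (R G))) →
  sum (λ k → χ (not (lookup S (vertex G (proj₁ (edge G k)))) ∧ not (lookup S (vertex G (proj₂ (edge G k))))))
    ≤ ∣ undominated (R G) S ∣ + sum (χ ∘ lookup S ∘ edgeVertex G)
edges-avoiding-≤ G S = begin
  sum (λ k → χ (avoids k))
    ≤⟨ sum-mono-≤ avoids≤ ⟩
  sum (λ k → χ (inU (edgeVertex G k)) + χ (lookup S (edgeVertex G k)))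
    ≡⟨ ∑-distrib-+ (χ ∘ inU ∘ edgeVertex G) (χ ∘ lookup S ∘ edgeVertex G) ⟩
  sum (χ ∘ inU ∘ edgeVertex G) + sum (χ ∘ lookup S ∘ edgeVertex G)
    ≤⟨ +-monoˡ-≤ _ (sum-↑ʳ-≤ (n G) (χ ∘ inU)) ⟩
  sum (χ ∘ inU) + sum (χ ∘ lookup S ∘ edgeVertex G)
    ≡⟨ cong (_+ sum (χ ∘ lookup S ∘ edgeVertex G)) (∣tabulate∣≡sum-χ inU) ⟨
  ∣ undominated (R G) S ∣ + sum (χ ∘ lookup S ∘ edgeVertex G) ∎
  where
  open ≤-Reasoning
  inU : Fin (n (R G)) → Bool
  inU v = not (lookup S v) ∧ not (dominated (R G) S v)
  avoids : Fin (numEdges G) → Bool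
  avoids k = not (lookup S (vertex G (proj₁ (edge G k)))) ∧ not (lookup S (vertex G (proj₂ (edge G k))))
  avoids≤ : ∀ k → χ (avoids k) ≤ χ (inU (edgeVertex G k)) + χ (lookup S (edgeVertex G k))
  avoids≤ k with lookup S (edgeVertex G k)
  ... | true = χ≤1 (avoids k)
  ... | false with lookup S (vertex G (proj₁ (edge G k))) in e₁∈S | lookup S (vertex G (proj₂ (edge G k))) in e₂∈S
  ...   | true  | _     = z≤n
  ...   | false | true  = z≤n
  ...   | false | false rewrite edgeVertex-undominated G S k e₁∈S e₂∈S = s≤s z≤n

-- The complete bipartite graph K_{p,q}

inP-↑ˡ : ∀ p q (i : Fin p) → inP p q (i ↑ˡ q) ≡ true
inP-↑ˡ p q i rewrite splitAt-↑ˡ p i q = refl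

inP-↑ʳ : ∀ p q (j : Fin q) → inP p q (p ↑ʳ j) ≡ false
inP-↑ʳ p q j rewrite splitAt-↑ʳ p q j = refl

adj-K-↑ˡ-↑ʳ : ∀ p q i j → adj (K p q) (i ↑ˡ q) (p ↑ʳ j) ≡ true
adj-K-↑ˡ-↑ʳ p q i j rewrite inP-↑ˡ p q i | inP-↑ʳ p q j = refl

adj-K-↑ʳ-↑ʳ : ∀ p q j j′ → adj (K p q) (p ↑ʳ j) (p ↑ʳ j′) ≡ false
adj-K-↑ʳ-↑ʳ p q j j′ rewrite inP-↑ʳ p q j | inP-↑ʳ p q j′ = refl

↑ˡ<↑ʳ : ∀ {p q} (i : Fin p) (j : Fin q) → i ↑ˡ q Fin.< p ↑ʳ j
↑ˡ<↑ʳ {p} {q} i j = subst₂ _<_ (sym (toℕ-↑ˡ i q)) (sym (toℕ-↑ʳ p j)) (≤-trans (toℕ<n i) (m≤m+n p (Fin.toℕ j)))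

↑ˡ-or-↑ʳ : ∀ p {q} (x : Fin (p + q)) → (∃ λ i → i ↑ˡ q ≡ x) ⊎ (∃ λ j → p ↑ʳ j ≡ x)
↑ˡ-or-↑ʳ p x with splitAt p x in eq
... | inj₁ i = inj₁ (i , splitAt⁻¹-↑ˡ eq)
... | inj₂ j = inj₂ (j , splitAt⁻¹-↑ʳ eq)

K-edge-source : ∀ p q {u w} → u Fin.< w → adj (K p q) u w ≡ true → ∃ λ i → i ↑ˡ q ≡ u
K-edge-source p q {u} {w} u<w uw with ↑ˡ-or-↑ʳ p u | ↑ˡ-or-↑ʳ p w
... | inj₁ u∈P          | _                 = u∈P
... | inj₂ (j , refl)   | inj₁ (i , refl)   = contradiction u<w (<-asym (↑ˡ<↑ʳ i j))
... | inj₂ (j , refl)   | inj₂ (j′ , refl)  = contradiction (trans (sym uw) (adj-K-↑ʳ-↑ʳ p q j j′)) λ ()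

K-edges-inside-≥ : ∀ p q (f : Fin (p + q) → Bool) →
  sum (χ ∘ f ∘ (_↑ˡ q)) * sum (χ ∘ f ∘ (p ↑ʳ_))
    ≤ sum (λ k → χ (f (proj₁ (edge (K p q) k)) ∧ f (proj₂ (edge (K p q) k))))
K-edges-inside-≥ p q f = begin
  sum (χ ∘ f ∘ (_↑ˡ q)) * sum (χ ∘ f ∘ (p ↑ʳ_))
    ≡⟨ *-distribʳ-sum (sum (χ ∘ f ∘ (p ↑ʳ_))) (χ ∘ f ∘ (_↑ˡ q)) ⟩
  sum (λ i → χ (f (i ↑ˡ q)) * sum (χ ∘ f ∘ (p ↑ʳ_)))
    ≡⟨ sum-cong-≗ (λ i → *-distribˡ-sum (χ (f (i ↑ˡ q))) (χ ∘ f ∘ (p ↑ʳ_))) ⟩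
  sum (λ i → sum λ j → χ (f (i ↑ˡ q)) * χ (f (p ↑ʳ j)))
    ≡⟨ sum-cong-≗ (λ i → sum-cong-≗ λ j → h′-across i j) ⟨
  sum (λ i → sum λ j → h′ (i ↑ˡ q , p ↑ʳ j))
    ≤⟨ sum-mono-≤ (λ i → sum-↑ʳ-≤ p (h′ ∘ (i ↑ˡ q ,_))) ⟩
  sum (λ i → sum λ w → h′ (i ↑ˡ q , w))
    ≤⟨ sum-↑ˡ-≤ p (λ u → sum λ w → h′ (u , w)) ⟩
  sum (λ u → sum λ w → h′ (u , w))
    ≡⟨ sum-edges (K p q) h ⟨
  sum (h ∘ edge (K p q)) ∎
  where
  open ≤-Reasoning
  h h′ : Fin (p + q) × Fin (p + q) → ℕ
  h e = χ (f (proj₁ e) ∧ f (proj₂ e))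
  h′ e = if does (isEdge? (K p q) e) then h e else 0
  h′-across : ∀ i j → h′ (i ↑ˡ q , p ↑ʳ j) ≡ χ (f (i ↑ˡ q)) * χ (f (p ↑ʳ j))
  h′-across i j rewrite dec-true (isEdge? (K p q) (i ↑ˡ q , p ↑ʳ j)) (↑ˡ<↑ʳ i j , adj-K-↑ˡ-↑ʳ p q i j) =
    χ-∧ (f (i ↑ˡ q)) (f (p ↑ʳ j))

-- Differential sets of R(K_{p,q})

p<q⇒4≤p+q⇒3≤q : ∀ {p q} → p < q → 4 ≤ p + q → 3 ≤ q
p<q⇒4≤p+q⇒3≤q p<q 4≤p+q = ≮⇒≥ λ q<3 →
  <⇒≱ 4≤p+q (+-mono-≤ (s≤s⁻¹ (≤-trans p<q (s≤s⁻¹ q<3))) (s≤s⁻¹ q<3))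

module RK (p q : ℕ) where

  G : Graph
  G = K p q

  H : Graph
  H = R G

  P : Subset (n H)
  P = Pset p q

  vP : Fin p → Fin (n H)
  vP i = vertex G (i ↑ˡ q)

  vQ : Fin q → Fin (n H)
  vQ j = vertex G (p ↑ʳ j)

  vE : Fin (numEdges G) → Fin (n H)
  vE = edgeVertex G

  sum-V : ∀ (f : Fin (n H) → ℕ) → sum f ≡ sum (f ∘ vP) + sum (f ∘ vQ) + sum (f ∘ vE)
  sum-V f = trans (sum-↑ˡ-↑ʳ (p + q) f) (cong (_+ sum (f ∘ vE)) (sum-↑ˡ-↑ʳ p (f ∘ vertex G)))

  P-vertex : ∀ x → lookup P (vertex G x) ≡ inP p q x
  P-vertex x rewrite (lookup P (vertex G x) ≡ _ ∋ lookup∘tabulate _ (vertex G x))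
                   | splitAt-↑ˡ (p + q) x (numEdges G) = refl

  P-vP : ∀ i → lookup P (vP i) ≡ true
  P-vP i = trans (P-vertex (i ↑ˡ q)) (inP-↑ˡ p q i)

  P-vQ : ∀ j → lookup P (vQ j) ≡ false
  P-vQ j = trans (P-vertex (p ↑ʳ j)) (inP-↑ʳ p q j)

  P-vE : ∀ k → lookup P (vE k) ≡ false
  P-vE k rewrite (lookup P (vE k) ≡ _ ∋ lookup∘tabulate _ (vE k))
               | splitAt-↑ʳ (p + q) (numEdges G) k = refl

  module Counts (S : Subset (n H)) where

    a x b y c U : ℕ
    a = sum (χ ∘ lookup S ∘ vP)
    x = sum (χ ∘ not ∘ lookup S ∘ vP)
    b = sum (χ ∘ lookup S ∘ vQ)
    y = sum (χ ∘ not ∘ lookup S ∘ vQ)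
    c = sum (χ ∘ lookup S ∘ vE)
    U = ∣ undominated H S ∣

    ∣S∣≡a+b+c : ∣ S ∣ ≡ a + b + c
    ∣S∣≡a+b+c = trans (∣∣≡sum-χ S) (sum-V (χ ∘ lookup S))

    a+x≡p : a + x ≡ p
    a+x≡p = sum-χ+χ-not (lookup S ∘ vP)

    b+y≡q : b + y ≡ q
    b+y≡q = sum-χ+χ-not (lookup S ∘ vQ)

    x*y≤U+c : x * y ≤ U + c
    x*y≤U+c = ≤-trans (K-edges-inside-≥ p q (not ∘ lookup S ∘ vertex G)) (edges-avoiding-≤ G S)

    cost≡a+a+[b+b+c+[U+c]] : cost H S ≡ (a + a) + (b + b + c + (U + c))
    cost≡a+a+[b+b+c+[U+c]] = trans (cong (λ t → t + t + U) ∣S∣≡a+b+c) (expand a b c U)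
      where
      expand : ∀ a b c U → (a + b + c) + (a + b + c) + U ≡ (a + a) + (b + b + c + (U + c))
      expand = solve-∀

    p+p≡a+a+[x+x] : p + p ≡ (a + a) + (x + x)
    p+p≡a+a+[x+x] = trans (cong₂ _+_ (sym a+x≡p) (sym a+x≡p)) (interchange a x a x)

    x<b+y : p < q → x < b + y
    x<b+y p<q = ≤-trans (s≤s (m≤n+m x a)) (subst₂ _<_ (sym a+x≡p) (sym b+y≡q) p<q)

    p+p≤cost : p < q → p + p ≤ cost H S
    p+p≤cost p<q = subst₂ _≤_ (sym p+p≡a+a+[x+x]) (sym cost≡a+a+[b+b+c+[U+c]])
      (+-monoʳ-≤ (a + a) (≤-trans (x+x≤b+b+x*y x b y (x<b+y p<q)) (+-mono-≤ (m≤m+n (b + b) c) x*y≤U+c)))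

    x≡0⇒b≡0⇒c≡0⇒S≡P : x ≡ 0 → b ≡ 0 → c ≡ 0 → S ≡ P
    x≡0⇒b≡0⇒c≡0⇒S≡P x≡0 b≡0 c≡0 =
      trans (sym (tabulate∘lookup S)) (trans (tabulate-cong agree) (tabulate∘lookup P))
      where
      on-P : ∀ i → lookup S (vP i) ≡ lookup P (vP i)
      on-P i = trans (not-injective (χ≡0⇒false (sum≡0⇒≡0 (χ ∘ not ∘ lookup S ∘ vP) x≡0 i)))
                     (sym (P-vP i))
      on-Q : ∀ j → lookup S (vQ j) ≡ lookup P (vQ j)
      on-Q j = trans (χ≡0⇒false (sum≡0⇒≡0 (χ ∘ lookup S ∘ vQ) b≡0 j))
                     (sym (P-vQ j))
      on-E : ∀ k → lookup S (vE k) ≡ lookup P (vE k)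
      on-E k = trans (χ≡0⇒false (sum≡0⇒≡0 (χ ∘ lookup S ∘ vE) c≡0 k)) (sym (P-vE k))
      agree : ∀ v → lookup S v ≡ lookup P v
      agree = ↑ˡ-↑ʳ-ext (p + q)
        (↑ˡ-↑ʳ-ext p {f = lookup S ∘ vertex G} {g = lookup P ∘ vertex G} on-P on-Q) on-E

    cost≤p+p⇒S≡P : p < q → 3 ≤ q → cost H S ≤ p + p → S ≡ P
    cost≤p+p⇒S≡P p<q 3≤q cost≤p+p =
      let x≡0 , b≡0 , c≡0 = b+b+c+x*y≤x+x⇒x≡b≡c≡0 x b y c (x<b+y p<q) (subst (3 ≤_) (sym b+y≡q) 3≤q) tight
      in  x≡0⇒b≡0⇒c≡0⇒S≡P x≡0 b≡0 c≡0
      where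
      tight : b + b + c + x * y ≤ x + x
      tight = +-cancelˡ-≤ (a + a) _ _ (≤-trans (+-monoʳ-≤ (a + a) (+-monoʳ-≤ (b + b + c) x*y≤U+c))
                (subst₂ _≤_ cost≡a+a+[b+b+c+[U+c]] p+p≡a+a+[x+x] cost≤p+p))

  open Counts public using (p+p≤cost; cost≤p+p⇒S≡P)

  ∣P∣≡p : ∣ P ∣ ≡ p
  ∣P∣≡p = begin
    ∣ P ∣
      ≡⟨ Counts.∣S∣≡a+b+c P ⟩
    sum (χ ∘ lookup P ∘ vP) + sum (χ ∘ lookup P ∘ vQ) + sum (χ ∘ lookup P ∘ vE)
      ≡⟨ cong₂ _+_ (cong₂ _+_ (sum-cong-≗ (cong χ ∘ P-vP)) (sum-zero (cong χ ∘ P-vQ))) (sum-zero (cong χ ∘ P-vE)) ⟩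
    sum {p} (λ _ → 1) + 0 + 0
      ≡⟨ cong (λ t → t + 0 + 0) (sum-ones p) ⟩
    p + 0 + 0
      ≡⟨ trans (+-identityʳ (p + 0)) (+-identityʳ p) ⟩
    p ∎
    where open ≡-Reasoning

  ∣undominated-P∣≡0 : Fin p → ∣ undominated H P ∣ ≡ 0
  ∣undominated-P∣≡0 i₀ = begin
    ∣ undominated H P ∣
      ≡⟨ ∣tabulate∣≡sum-χ inU ⟩
    sum (χ ∘ inU)
      ≡⟨ sum-V (χ ∘ inU) ⟩
    sum (χ ∘ inU ∘ vP) + sum (χ ∘ inU ∘ vQ) + sum (χ ∘ inU ∘ vE)
      ≡⟨ cong₂ _+_ (cong₂ _+_ (sum-zero (in-P ∘ P-vP)) (sum-zero (dominated-by-P ∘ vQ-dominated)))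
                   (sum-zero (dominated-by-P ∘ vE-dominated)) ⟩
    0 ∎
    where
    open ≡-Reasoning
    inU : Fin (n H) → Bool
    inU v = not (lookup P v) ∧ not (dominated H P v)
    in-P : ∀ {v} → lookup P v ≡ true → χ (inU v) ≡ 0
    in-P {v} v∈P rewrite v∈P = refl
    dominated-by-P : ∀ {v} → dominated H P v ≡ true → χ (inU v) ≡ 0
    dominated-by-P {v} v-dom rewrite v-dom = cong χ (∧-zeroʳ _)
    vQ-dominated : ∀ j → dominated H P (vQ j) ≡ true
    vQ-dominated j = anyFin-true _ (vP i₀)
      (cong₂ _∧_ (P-vP i₀) (trans (adj-R-vertex-vertex G _ _) (adj-K-↑ˡ-↑ʳ p q i₀ j)))
    vE-dominated : ∀ k → dominated H P (vE k) ≡ true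
    vE-dominated k with K-edge-source p q (proj₁ (edge-isEdge G k)) (proj₂ (edge-isEdge G k))
    ... | i , i↑ˡq≡e₁ = anyFin-true _ (vertex G e₁)
      (cong₂ _∧_ (trans (P-vertex e₁) (subst (λ u → inP p q u ≡ true) i↑ˡq≡e₁ (inP-↑ˡ p q i)))
                 (trans (adj-R-vertex-edgeVertex G e₁ k) (endpoint-isEnd G k)))
      where e₁ = proj₁ (edge G k)

  cost-P : Fin p → cost H P ≡ p + p
  cost-P i₀ = trans (cong₂ (λ s u → s + s + u) ∣P∣≡p (∣undominated-P∣≡0 i₀)) (+-identityʳ (p + p))

proposition2p10 : (p q : ℕ) → 1 ≤ p → 1 ≤ q → 4 ≤ p + q → p < q →
    IsDifferential (R (K p q)) (Pset p q) ×
    ((S : Subset (n (R (K p q)))) → IsDifferential (R (K p q)) S → S ≡ Pset p q)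
-- The hypothesis 1 ≤ q is implied by p < q.
proposition2p10 p q 1≤p _ 4≤p+q p<q = P-differential , P-unique
  where
  open RK p q
  cost-P≡p+p : cost H P ≡ p + p
  cost-P≡p+p = cost-P (Fin.fromℕ< 1≤p)
  P-differential : IsDifferential H P
  P-differential T = cost-≤⇒diff-≥ H P T (subst (_≤ cost H T) (sym cost-P≡p+p) (p+p≤cost T p<q))
  P-unique : ∀ S → IsDifferential H S → S ≡ P
  P-unique S S-differential = cost≤p+p⇒S≡P S p<q (p<q⇒4≤p+q⇒3≤q p<q 4≤p+q)
    (subst (cost H S ≤_) cost-P≡p+p (diff-≤⇒cost-≥ H S P (S-differential P)))
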